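{- Let $\mathcal M$ be a faithful $n$-maniplex and let $u$ and $v$ be two flags of $\mathcal M$. If $u$ and $v$ lie in the same $j$-face of $\mathcal M$ for some $j\in[n]$, then $u$ is not $j$-adjacent to $v$.
   Context: $[n]=\{0,\dots,n-1\}$. An $n$-maniplex is a finite simple connected $n$-valent graph with a proper edge-colouring by $[n]$ such that, whenever $|i-j|>1$, every connected subgraph induced by edges of colours $i$ and $j$ is a $4$-cycle. Vertices are flags; flags joined by an edge of colour $i$ are $i$-adjacent. A $j$-face is a connected component of the subgraph obtained by deleting all edges of colour $j$. The maniplex is faithful if for every flag $\Phi$, the intersection of all faces (of ranks $0,\dots,n-1$) containing $\Phi$ consists of $\Phi$ only. -}

module Defs where

open import Data.Nat using (ℕ; _<_; suc)
open import Data.Fin using (Fin; toℕ)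
open import Data.Sum using (_⊎_)
open import Data.Unit using (⊤)
open import Relation.Binary.PropositionalEquality using (_≡_; _≢_)

Far : ℕ → ℕ → Set
Far a b = (suc a < b) ⊎ (suc b < a)

data Reach {m n : ℕ} (r : Fin n → Fin m → Fin m) (P : Fin n → Set)
           : Fin m → Fin m → Set where
  here : ∀ {x} → Reach r P x x
  step : ∀ {x y} (i : Fin n) → P i → Reach r P (r i x) y → Reach r P x y

-- A proper n-edge-colouring
-- of an n-valent simple graph is the same as: for each colour i, the
-- i-edges form a perfect matching, i.e. a fixed-point-free involution r i
-- (r i x is the unique flag i-adjacent to x); simplicity says that no two
-- different colours join the same pair of flags.
record Maniplex (n m : ℕ) : Set where
  field
    r          : Fin n → Fin m → Fin m
    involutive : ∀ i x → r i (r i x) ≡ x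
    no-loop    : ∀ i x → r i x ≢ x
    simple     : ∀ i j x → i ≢ j → r i x ≢ r j x
    connected  : ∀ x y → Reach r (λ _ → ⊤) x y
    -- for |i - j| > 1, each connected {i,j}-subgraph is a 4-cycle
    -- x, r i x, r j (r i x), r i (r j (r i x)) = r j x, closing back to x.
    four-cycle : ∀ i j x → Far (toℕ i) (toℕ j) →
                 r j (r i (r j (r i x))) ≡ x
  -- note: distinctness of the four vertices follows from no-loop/simple

open Maniplex public

SameFace : ∀ {n m} → Maniplex n m → Fin n → Fin m → Fin m → Set
SameFace M j x y = Reach (r M) (λ i → i ≢ j) x y

Faithful : ∀ {n m} → Maniplex n m → Set
Faithful {n} {m} M = ∀ (Φ Ψ : Fin m) → (∀ (j : Fin n) → SameFace M j Φ Ψ) → Ψ ≡ Φ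

Adjacent : ∀ {n m} → Maniplex n m → Fin n → Fin m → Fin m → Set
Adjacent M j u v = r M j u ≡ v

{-# OPTIONS --safe #-}
module Submission where

open import Defs
open import Data.Nat using (ℕ)
open import Data.Fin using (Fin; _≟_)
open import Relation.Nullary using (¬_; yes; no)
open import Relation.Binary.PropositionalEquality using (_≡_; _≢_; refl; sym; subst)

-- If v = u·j lay in the j-face of u, then v would lie in every face of u
-- (for k ≢ j the j-edge itself stays inside the k-face), so faithfulness
-- would force v = u, contradicting that r j has no fixed points.

module _ {n m : ℕ} (M : Maniplex n m) where

  adjacent⇒sameFace : ∀ {i j : Fin n} {u v : Fin m} →
                      i ≢ j → Adjacent M i u v → SameFace M j u v
  adjacent⇒sameFace {i} i≢j refl = step i i≢j here

  sameFace∧adjacent⇒sameFaces : ∀ {j : Fin n} {u v : Fin m} →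
                                SameFace M j u v → Adjacent M j u v →
                                ∀ (k : Fin n) → SameFace M k u v
  sameFace∧adjacent⇒sameFaces {j} sf adj k with k ≟ j
  ... | yes refl = sf
  ... | no k≢j   = adjacent⇒sameFace (λ j≡k → k≢j (sym j≡k)) adj

lemma1 : ∀ {n m : ℕ} (M : Maniplex n m) → Faithful M →
         ∀ (u v : Fin m) (j : Fin n) →
         SameFace M j u v → ¬ Adjacent M j u v
lemma1 M faithful u v j sf adj = no-loop M j u (subst (r M j u ≡_) v≡u adj)
  where
  v≡u : v ≡ u
  v≡u = faithful u v (sameFace∧adjacent⇒sameFaces M sf adj)
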